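{- Let $d=-7$, $\omega=\frac12+\frac{\sqrt{ -7}}{2}$ and $k\ge2$, $L=k-1$. Let $T_{2k}^4$ be the $\mathcal{L}$-graph on uncharged vertices $1,\dots,2k$ with edges, for each $1\le i\le L-1$: $\{i,i+1\}$ label $1$, $\{L+i,L+i+1\}$ label $-1$, $\{i,L+i+1\}$ label $1$, $\{i+1,L+i\}$ label $-1$; together with $\{1,2L+1\}$ label $\omega$, $\{L+1,2L+1\}$ label $\omega$, $\{L,2L+2\}$ label $\omega$, $\{2L,2L+2\}$ label $-\omega$. Let $T_{2k}^{4'}$ be the same except that $\{L,2L+2\}$ has label $\bar\omega$ and $\{2L,2L+2\}$ has label $-\bar\omega$. Then $T_{2k}^{4'}$ is not equivalent to $T_{2k}^4$.
   Context: $R=\mathcal{O}_{\mathbb{Q}(\sqrt{ -7})}$. An $\mathcal{L}$-graph is identified with its Hermitian adjacency matrix $A$; an edge $\{i,j\}$ with $i<j$ and label $x$ means $A_{ij}=x$, $A_{ji}=\bar x$; unlisted off-diagonal entries and all diagonal entries (uncharged vertices) are $0$. Matrices $A,A'$ are equivalent if $A'=DPXP^{T}D$ for some $X\in\{A,-A,\bar A,-\bar A\}$, permutation matrix $P$ and diagonal matrix $D$ with diagonal entries $\pm1$. -}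

module Defs where

open import Data.Nat as ℕ using (ℕ; zero; suc; _∸_; _≟_)
open import Data.Integer as ℤ using (ℤ; +_; -[1+_])
open import Data.Fin using (Fin; toℕ)
open import Data.Fin.Permutation using (Permutation′; _⟨$⟩ʳ_)
open import Data.List using (List; []; _∷_; map; concatMap; foldr; upTo)
open import Data.Product using (Σ; _×_; _,_)
open import Data.Sign using (Sign)
open import Relation.Nullary.Decidable using (⌊_⌋)
open import Data.Bool using (Bool; true; false; _∧_; if_then_else_)
open import Relation.Binary.PropositionalEquality using (_≡_)

-- The ring of integers R = Z[ω] of Q(√-7), ω = (1 + √-7)/2, ω² = ω - 2.
-- An element  re + im·ω  is stored as the pair (re, im); this representation is unique.
record R : Set where
  constructor _+_ω
  field
    re : ℤ
    im : ℤ
open R public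

infixl 6 _⊕_
infixl 7 _⊗_

0R 1R ω : R
0R = (+ 0) + (+ 0) ω
1R = (+ 1) + (+ 0) ω
ω  = (+ 0) + (+ 1) ω

_⊕_ : R → R → R
(a + b ω) ⊕ (c + d ω) = (a ℤ.+ c) + (b ℤ.+ d) ω

-- (a + bω)(c + dω) = ac - 2bd + (ad + bc + bd)ω   using ω² = ω - 2
_⊗_ : R → R → R
(a + b ω) ⊗ (c + d ω) =
  (a ℤ.* c ℤ.- (+ 2) ℤ.* b ℤ.* d) + (a ℤ.* d ℤ.+ b ℤ.* c ℤ.+ b ℤ.* d) ω

neg : R → R
neg (a + b ω) = (ℤ.- a) + (ℤ.- b) ω

-- complex conjugation:  ω̄ = 1 - ω,  so  conj(a + bω) = (a + b) - bω
conj : R → R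
conj (a + b ω) = (a ℤ.+ b) + (ℤ.- b) ω

sumR : List R → R
sumR = foldr _⊕_ 0R

Matrix : ℕ → Set
Matrix n = Fin n → Fin n → R

-- An edge {p,q} (1-based vertex numbers, p < q) with label x.
Edge : Set
Edge = ℕ × ℕ × R

_==_ : ℕ → ℕ → Bool
m == n = ⌊ m ≟ n ⌋

-- Adjacency matrix of the L-graph on n uncharged vertices given by an edge list:
-- A_pq = x, A_qp = x̄ for an edge {p,q} (p<q) with label x; other entries 0.
-- (Vertex index i : Fin n corresponds to vertex number toℕ i + 1.)
adj : (n : ℕ) → List Edge → Matrix n
adj n es i j = sumR (map entry es)
  where
  p = suc (toℕ i)
  q = suc (toℕ j)
  entry : Edge → R
  entry (a , b , x) =
    if (p == a) ∧ (q == b) then x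
    else if (p == b) ∧ (q == a) then conj x
    else 0R

commonEdges : ℕ → List Edge
commonEdges L =
  concatMap (λ j → let i = suc j in
      (i , suc i , 1R)
    ∷ (L ℕ.+ i , suc (L ℕ.+ i) , neg 1R)
    ∷ (i , suc (L ℕ.+ i) , 1R)
    ∷ (suc i , L ℕ.+ i , neg 1R)
    ∷ [])
    (upTo (L ∸ 1))
  Data.List.++
  ( (1 , suc (2 ℕ.* L) , ω)
  ∷ (suc L , suc (2 ℕ.* L) , ω)
  ∷ [])

T4 : (k : ℕ) → Matrix (2 ℕ.* k)
T4 k = adj (2 ℕ.* k) (commonEdges L Data.List.++
                       ((L , 2 ℕ.+ 2 ℕ.* L , ω) ∷ (2 ℕ.* L , 2 ℕ.+ 2 ℕ.* L , neg ω) ∷ []))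
  where L = k ∸ 1

T4′ : (k : ℕ) → Matrix (2 ℕ.* k)
T4′ k = adj (2 ℕ.* k) (commonEdges L Data.List.++
                       ((L , 2 ℕ.+ 2 ℕ.* L , conj ω) ∷ (2 ℕ.* L , 2 ℕ.+ 2 ℕ.* L , neg (conj ω)) ∷ []))
  where L = k ∸ 1

data Twist : Set where
  plain negate conjugate negconj : Twist

twist : Twist → R → R
twist plain     x = x
twist negate    x = neg x
twist conjugate x = conj x
twist negconj   x = neg (conj x)

signR : Sign → R
signR Sign.+ = 1R
signR Sign.- = neg 1R

-- A′ = D P X Pᵀ D, written entrywise: with P the permutation matrix of σ
-- (P_ik = 1 iff σ i = k) and D = diag(ε), (D P X Pᵀ D)_ij = ε_i ε_j X_{σ i, σ j}.
Equivalent : {n : ℕ} → Matrix n → Matrix n → Set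
Equivalent {n} A A′ =
  Σ Twist λ t → Σ (Permutation′ n) λ σ → Σ (Fin n → Sign) λ ε →
    ∀ i j → A′ i j ≡ signR (ε i) ⊗ signR (ε j) ⊗ twist t (A (σ ⟨$⟩ʳ i) (σ ⟨$⟩ʳ j))

module Submission where

-- Write N = 2L for the number of "low" vertices 1,…,N of T⁴_{2k};
-- the two remaining vertices N+1, N+2 are "high".  Every edge of T⁴ starts at a
-- low vertex; edges between low vertices carry integer labels and edges going up
-- carry multiples of ω.  Consequently every entry Aₚq of T⁴ lies on one of the
-- three lines ℤ, ℤω, ℤω̄ of R, and it lies on ℤω only if q is high, on ℤω̄ only
-- if p is high.  An equivalence A′ = D P X Pᵀ D moves entries along with the
-- vertices, keeps each line fixed up to sign and, if X is a conjugate, swaps ℤω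
-- and ℤω̄.  In T⁴′ the entries (1,N+1), (L+1,N+1) equal ω and (L,N+2), (N,N+2)
-- equal ±ω̄, each lying on exactly one line.  Transporting these four entries
-- forces three distinct vertices of T⁴ to be high — σ(N+1), σ(L), σ(N) if X = ±A,
-- and σ(1), σ(L+1), σ(N+2) if X = ±Ā — but there are only two high vertices.

open import Defs
open import Data.Nat as ℕ using (ℕ; zero; suc; pred; _≤_; _<_; _≟_; _≤?_; z≤n; s≤s)
import Data.Nat.Properties as ℕP
open import Data.Integer as ℤ using (+_)
import Data.Integer.Properties as ℤP
open import Data.Integer.Tactic.RingSolver using (solve-∀)
open import Data.Fin using (Fin; toℕ; fromℕ<)
open import Data.Fin.Properties using (toℕ-injective; toℕ-fromℕ<; toℕ<n)
open import Data.Fin.Permutation using (Permutation′; _⟨$⟩ʳ_; _⟨$⟩ˡ_; inverseˡ)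
open import Data.List using (List; []; _∷_; map; _++_; concatMap; upTo)
open import Data.List.Properties using (++-assoc)
open import Data.List.Relation.Unary.All as All using (All; []; _∷_)
open import Data.List.Relation.Unary.All.Properties using (++⁺; concat⁺; map⁺; all-upTo)
open import Data.Product using (Σ; _×_; _,_)
open import Data.Sum using (_⊎_; inj₁; inj₂)
open import Data.Unit using (⊤; tt)
open import Function using (_∘′_)
open import Data.Empty using (⊥; ⊥-elim)
open import Data.Bool using (_∧_; if_then_else_)
open import Data.Sign as Sign using (Sign)
open import Relation.Nullary using (¬_; Dec; yes; no)
open import Relation.Nullary.Decidable using (⌊_⌋)
open import Relation.Binary.PropositionalEquality

num : ∀ {n} → Fin n → ℕ
num i = suc (toℕ i)

-- The three lines ℤ, ℤω, ℤω̄ of R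

data Line : Set where
  integers multiplesOfω multiplesOfω̄ : Line

-- x = re + im·ω lies on ℤ iff im = 0, on ℤω iff re = 0, on ℤω̄ = ℤ(1 - ω) iff re + im = 0.
On : Line → R → Set
On integers      x = im x ≡ + 0
On multiplesOfω  x = re x ≡ + 0
On multiplesOfω̄ x = re x ℤ.+ im x ≡ + 0

Pure : Line → R → Set
Pure ℓ x = ∀ ℓ′ → On ℓ′ x → ℓ′ ≡ ℓ

on-0R : ∀ ℓ → On ℓ 0R
on-0R integers      = refl
on-0R multiplesOfω  = refl
on-0R multiplesOfω̄ = refl

on-⊕ : ∀ ℓ {x y} → On ℓ x → On ℓ y → On ℓ (x ⊕ y)
on-⊕ integers      hx hy = cong₂ ℤ._+_ hx hy
on-⊕ multiplesOfω  hx hy = cong₂ ℤ._+_ hx hy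
on-⊕ multiplesOfω̄ {x} {y} hx hy =
  trans (interchange (re x) (re y) (im x) (im y)) (cong₂ ℤ._+_ hx hy)
  where
  interchange : ∀ a b c d → (a ℤ.+ b) ℤ.+ (c ℤ.+ d) ≡ (a ℤ.+ c) ℤ.+ (b ℤ.+ d)
  interchange = solve-∀

on-neg : ∀ ℓ {x} → On ℓ x → On ℓ (neg x)
on-neg integers      hx = cong ℤ.-_ hx
on-neg multiplesOfω  hx = cong ℤ.-_ hx
on-neg multiplesOfω̄ {x} hx =
  trans (sym (ℤP.neg-distrib-+ (re x) (im x))) (cong ℤ.-_ hx)

-- Complex conjugation fixes ℤ and swaps ℤω with ℤω̄.
flip : Line → Line
flip integers      = integers
flip multiplesOfω  = multiplesOfω̄
flip multiplesOfω̄ = multiplesOfω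

flip-involutive : ∀ ℓ → flip (flip ℓ) ≡ ℓ
flip-involutive integers      = refl
flip-involutive multiplesOfω  = refl
flip-involutive multiplesOfω̄ = refl

on-conj : ∀ ℓ {x} → On ℓ x → On (flip ℓ) (conj x)
on-conj integers      hx = cong ℤ.-_ hx
on-conj multiplesOfω  {x} hx = trans (cancel (re x) (im x)) hx
  where
  cancel : ∀ a b → (a ℤ.+ b) ℤ.+ ℤ.- b ≡ a
  cancel = solve-∀
on-conj multiplesOfω̄ hx = hx

neg-involutive : ∀ x → neg (neg x) ≡ x
neg-involutive x = cong₂ _+_ω (ℤP.neg-involutive (re x)) (ℤP.neg-involutive (im x))

pure-neg : ∀ {ℓ x} → Pure ℓ x → Pure ℓ (neg x)
pure-neg {x = x} pure ℓ′ h = pure ℓ′ (subst (On ℓ′) (neg-involutive x) (on-neg ℓ′ h))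

pure-ω : Pure multiplesOfω ω
pure-ω integers      ()
pure-ω multiplesOfω  _ = refl
pure-ω multiplesOfω̄ ()

ω̄ : R
ω̄ = conj ω

pure-ω̄ : Pure multiplesOfω̄ ω̄
pure-ω̄ integers      ()
pure-ω̄ multiplesOfω  ()
pure-ω̄ multiplesOfω̄ _ = refl

twistLine : Twist → Line → Line
twistLine plain     ℓ = ℓ
twistLine negate    ℓ = ℓ
twistLine conjugate ℓ = flip ℓ
twistLine negconj   ℓ = flip ℓ

twistLine-involutive : ∀ t ℓ → twistLine t (twistLine t ℓ) ≡ ℓ
twistLine-involutive plain     ℓ = refl
twistLine-involutive negate    ℓ = refl
twistLine-involutive conjugate ℓ = flip-involutive ℓ
twistLine-involutive negconj   ℓ = flip-involutive ℓ

on-twist : ∀ t ℓ {x} → On ℓ x → On (twistLine t ℓ) (twist t x)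
on-twist plain     ℓ h = h
on-twist negate    ℓ h = on-neg ℓ h
on-twist conjugate ℓ h = on-conj ℓ h
on-twist negconj   ℓ h = on-neg (flip ℓ) (on-conj ℓ h)

sign-product : ∀ s s′ → signR s ⊗ signR s′ ≡ signR (s Sign.* s′)
sign-product Sign.+ Sign.+ = refl
sign-product Sign.+ Sign.- = refl
sign-product Sign.- Sign.+ = refl
sign-product Sign.- Sign.- = refl

⊗-identityˡ : ∀ x → 1R ⊗ x ≡ x
⊗-identityˡ x = cong₂ _+_ω (reᵉ (re x) (im x)) (imᵉ (re x) (im x))
  where
  reᵉ : ∀ a b → + 1 ℤ.* a ℤ.- + 2 ℤ.* + 0 ℤ.* b ≡ a
  reᵉ = solve-∀
  imᵉ : ∀ a b → + 1 ℤ.* b ℤ.+ + 0 ℤ.* a ℤ.+ + 0 ℤ.* b ≡ b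
  imᵉ = solve-∀

-1⊗ : ∀ x → neg 1R ⊗ x ≡ neg x
-1⊗ x = cong₂ _+_ω (reᵉ (re x) (im x)) (imᵉ (re x) (im x))
  where
  reᵉ : ∀ a b → ℤ.- (+ 1) ℤ.* a ℤ.- + 2 ℤ.* ℤ.- (+ 0) ℤ.* b ≡ ℤ.- a
  reᵉ = solve-∀
  imᵉ : ∀ a b → ℤ.- (+ 1) ℤ.* b ℤ.+ ℤ.- (+ 0) ℤ.* a ℤ.+ ℤ.- (+ 0) ℤ.* b ≡ ℤ.- b
  imᵉ = solve-∀

on-sign : ∀ s ℓ {x} → On ℓ x → On ℓ (signR s ⊗ x)
on-sign Sign.+ ℓ {x} h = subst (On ℓ) (sym (⊗-identityˡ x)) h
on-sign Sign.- ℓ {x} h = subst (On ℓ) (sym (-1⊗ x)) (on-neg ℓ h)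

on-equivalent-entry : ∀ t s s′ ℓ {x} → On ℓ x →
  On (twistLine t ℓ) (signR s ⊗ signR s′ ⊗ twist t x)
on-equivalent-entry t s s′ ℓ {x} h =
  subst (λ u → On (twistLine t ℓ) (u ⊗ twist t x)) (sym (sign-product s s′))
        (on-sign (s Sign.* s′) (twistLine t ℓ) (on-twist t ℓ h))

-- The contribution of one edge to the entry at position (p , q); by definition
-- adj n es i j is the sum of these contributions at (num i , num j).
entry : ℕ → ℕ → Edge → R
entry p q (a , b , x) =
  if (p == a) ∧ (q == b) then x
  else if (p == b) ∧ (q == a) then conj x
  else 0R

data Meets (p q : ℕ) : Edge → R → Set where
  forward  : ∀ x → Meets p q (p , q , x) x
  backward : ∀ x → Meets p q (q , p , x) (conj x)
  missed   : ∀ e → Meets p q e 0R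

meets-by : ∀ {p q a b} x (d₁ : Dec (p ≡ a)) (d₂ : Dec (q ≡ b)) (d₃ : Dec (p ≡ b)) (d₄ : Dec (q ≡ a)) →
  Meets p q (a , b , x) (if ⌊ d₁ ⌋ ∧ ⌊ d₂ ⌋ then x else if ⌊ d₃ ⌋ ∧ ⌊ d₄ ⌋ then conj x else 0R)
meets-by x (yes refl) (yes refl) _          _          = forward x
meets-by x (yes _)    (no _)     (yes refl) (yes refl) = backward x
meets-by x (yes _)    (no _)     (yes _)    (no _)     = missed _
meets-by x (yes _)    (no _)     (no _)     _          = missed _
meets-by x (no _)     _          (yes refl) (yes refl) = backward x
meets-by x (no _)     _          (yes _)    (no _)     = missed _
meets-by x (no _)     _          (no _)     _          = missed _

meets : ∀ p q e → Meets p q e (entry p q e)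
meets p q (a , b , x) = meets-by x (p ≟ a) (q ≟ b) (p ≟ b) (q ≟ a)

entry-hit : ∀ p q x → entry p q (p , q , x) ≡ x
entry-hit p q x = hit-by (p ≟ p) (q ≟ q) (p ≟ q) (q ≟ p)
  where
  hit-by : ∀ (d₁ : Dec (p ≡ p)) (d₂ : Dec (q ≡ q)) (d₃ : Dec (p ≡ q)) (d₄ : Dec (q ≡ p)) →
    (if ⌊ d₁ ⌋ ∧ ⌊ d₂ ⌋ then x else if ⌊ d₃ ⌋ ∧ ⌊ d₄ ⌋ then conj x else 0R) ≡ x
  hit-by (yes _) (yes _) _ _ = refl
  hit-by (no p≢p) _ _ _ = ⊥-elim (p≢p refl)
  hit-by (yes _) (no q≢q) _ _ = ⊥-elim (q≢q refl)

entry-miss : ∀ {p q a b} x → (p ≢ a ⊎ q ≢ b) → q ≢ a → entry p q (a , b , x) ≡ 0R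
entry-miss {p} {q} {a} {b} x differs q≢a with entry p q (a , b , x) | meets p q (a , b , x)
... | _ | missed _ = refl
... | _ | forward _ with differs
...   | inj₁ p≢p = ⊥-elim (p≢p refl)
...   | inj₂ q≢q = ⊥-elim (q≢q refl)
entry-miss x differs q≢a | _ | backward _ = ⊥-elim (q≢a refl)

-- Graphs oriented upwards over N

Oriented : ℕ → Edge → Set
Oriented N (a , b , x) = a ≤ N × (b ≤ N × On integers x ⊎ N < b × On multiplesOfω x)

data Sides (N p q : ℕ) : Line → Set where
  both-low   : p ≤ N → q ≤ N → Sides N p q integers
  both-high  : N < p → N < q → Sides N p q integers
  going-up   : p ≤ N → N < q → Sides N p q multiplesOfω
  going-down : N < p → q ≤ N → Sides N p q multiplesOfω̄

sides : ∀ N p q → Σ Line (Sides N p q)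
sides N p q with p ≤? N | q ≤? N
... | yes p≤N | yes q≤N = integers , both-low p≤N q≤N
... | no  p≰N | no  q≰N = integers , both-high (ℕP.≰⇒> p≰N) (ℕP.≰⇒> q≰N)
... | yes p≤N | no  q≰N = multiplesOfω , going-up p≤N (ℕP.≰⇒> q≰N)
... | no  p≰N | yes q≤N = multiplesOfω̄ , going-down (ℕP.≰⇒> p≰N) q≤N

HighEnd : ℕ → ℕ → ℕ → Line → Set
HighEnd N p q integers      = ⊤
HighEnd N p q multiplesOfω  = N < q
HighEnd N p q multiplesOfω̄ = N < p

high-end : ∀ {N p q ℓ} → Sides N p q ℓ → HighEnd N p q ℓ
high-end (both-low _ _)     = tt
high-end (both-high _ _)    = tt
high-end (going-up _ N<q)   = N<q
high-end (going-down N<p _) = N<p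

forward-on : ∀ {N p q ℓ x} → Sides N p q ℓ → Oriented N (p , q , x) → On ℓ x
forward-on (both-low _ _)     (_ , inj₁ (_ , h))   = h
forward-on (both-low _ q≤N)   (_ , inj₂ (N<q , _)) = ⊥-elim (ℕP.<⇒≱ N<q q≤N)
forward-on (both-high N<p _)  (p≤N , _)            = ⊥-elim (ℕP.<⇒≱ N<p p≤N)
forward-on (going-up _ N<q)   (_ , inj₁ (q≤N , _)) = ⊥-elim (ℕP.<⇒≱ N<q q≤N)
forward-on (going-up _ _)     (_ , inj₂ (_ , h))   = h
forward-on (going-down N<p _) (p≤N , _)            = ⊥-elim (ℕP.<⇒≱ N<p p≤N)

backward-on : ∀ {N p q ℓ x} → Sides N p q ℓ → Oriented N (q , p , x) → On ℓ (conj x)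
backward-on {x = x} (both-low _ _)   (_ , inj₁ (_ , h))   = on-conj integers {x} h
backward-on (both-low p≤N _)         (_ , inj₂ (N<p , _)) = ⊥-elim (ℕP.<⇒≱ N<p p≤N)
backward-on (both-high _ N<q)        (q≤N , _)            = ⊥-elim (ℕP.<⇒≱ N<q q≤N)
backward-on (going-up _ N<q)         (q≤N , _)            = ⊥-elim (ℕP.<⇒≱ N<q q≤N)
backward-on (going-down N<p _)       (_ , inj₁ (p≤N , _)) = ⊥-elim (ℕP.<⇒≱ N<p p≤N)
backward-on {x = x} (going-down _ _) (_ , inj₂ (_ , h))   = on-conj multiplesOfω {x} h

edge-on : ∀ {N p q ℓ} → Sides N p q ℓ → ∀ e → Oriented N e → On ℓ (entry p q e)
edge-on {p = p} {q} {ℓ} s e o with entry p q e | meets p q e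
... | _ | forward  _ = forward-on s o
... | _ | backward _ = backward-on s o
... | _ | missed   _ = on-0R ℓ

sum-on : ∀ ℓ (f : Edge → R) {es} → All (λ e → On ℓ (f e)) es → On ℓ (sumR (map f es))
sum-on ℓ f []       = on-0R ℓ
sum-on ℓ f (h ∷ hs) = on-⊕ ℓ h (sum-on ℓ f hs)

Placed : ℕ → ℕ → ℕ → R → Set
Placed N p q y = Σ Line λ ℓ → On ℓ y × HighEnd N p q ℓ

oriented-placed : ∀ {N n es} → All (Oriented N) es →
  ∀ (i j : Fin n) → Placed N (num i) (num j) (adj n es i j)
oriented-placed {N} os i j with sides N (num i) (num j)
... | ℓ , s = ℓ , sum-on ℓ (entry (num i) (num j)) (All.map (λ {e} → edge-on s e) os) , high-end s

-- Transporting placement along an equivalence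

σ-injective : ∀ {n} (σ : Permutation′ n) {i j} → σ ⟨$⟩ʳ i ≡ σ ⟨$⟩ʳ j → i ≡ j
σ-injective σ {i} {j} e = trans (sym (inverseˡ σ)) (trans (cong (σ ⟨$⟩ˡ_) e) (inverseˡ σ))

transfer : ∀ {N n} {A A′ : Matrix n} → (∀ i j → Placed N (num i) (num j) (A i j)) →
  ∀ t (σ : Permutation′ n) (ε : Fin n → Sign) →
  (∀ i j → A′ i j ≡ signR (ε i) ⊗ signR (ε j) ⊗ twist t (A (σ ⟨$⟩ʳ i) (σ ⟨$⟩ʳ j))) →
  ∀ i j {ℓ} → Pure ℓ (A′ i j) → HighEnd N (num (σ ⟨$⟩ʳ i)) (num (σ ⟨$⟩ʳ j)) (twistLine t ℓ)
transfer {N} placed t σ ε eq i j {ℓ} pure with placed (σ ⟨$⟩ʳ i) (σ ⟨$⟩ʳ j)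
... | ℓ′ , on , high = subst (HighEnd N _ _) ℓ′≡ high
  where
  twisted≡ : twistLine t ℓ′ ≡ ℓ
  twisted≡ = pure (twistLine t ℓ′)
    (subst (On (twistLine t ℓ′)) (sym (eq i j)) (on-equivalent-entry t (ε i) (ε j) ℓ′ on))
  ℓ′≡ : ℓ′ ≡ twistLine t ℓ
  ℓ′≡ = trans (sym (twistLine-involutive t ℓ′)) (cong (twistLine t) twisted≡)

top-two : ∀ {N n} → n ≤ 2 ℕ.+ N → (u : Fin n) → N < num u → toℕ u ≡ N ⊎ toℕ u ≡ suc N
top-two n≤ u (s≤s N≤u) with ℕP.m≤n⇒m<n∨m≡n (ℕP.≤-pred (ℕP.≤-trans (toℕ<n u) n≤))
... | inj₁ u<sN = inj₁ (ℕP.≤-antisym (ℕP.≤-pred u<sN) N≤u)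
... | inj₂ u≡sN = inj₂ u≡sN

at-most-two-high : ∀ {N n} → n ≤ 2 ℕ.+ N → (x y z : Fin n) → x ≢ y → y ≢ z → x ≢ z →
  N < num x → N < num y → N < num z → ⊥
at-most-two-high n≤ x y z x≢y y≢z x≢z hx hy hz
  with top-two n≤ x hx | top-two n≤ y hy | top-two n≤ z hz
... | inj₁ a | inj₁ b | _      = x≢y (toℕ-injective (trans a (sym b)))
... | inj₂ a | inj₂ b | _      = x≢y (toℕ-injective (trans a (sym b)))
... | inj₁ a | inj₂ _ | inj₁ c = x≢z (toℕ-injective (trans a (sym c)))
... | inj₂ a | inj₁ _ | inj₂ c = x≢z (toℕ-injective (trans a (sym c)))
... | inj₁ _ | inj₂ b | inj₂ c = y≢z (toℕ-injective (trans b (sym c)))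
... | inj₂ _ | inj₁ b | inj₁ c = y≢z (toℕ-injective (trans b (sym c)))

LowEdge : ℕ → Edge → Set
LowEdge N (a , b , x) = a ≤ N × b ≤ N × On integers x

low-oriented : ∀ {N} e → LowEdge N e → Oriented N e
low-oriented (a , b , x) (a≤N , b≤N , h) = a≤N , inj₁ (b≤N , h)

entry-miss-high : ∀ {N} p q a b x → a ≤ N → N < q → (p ≢ a ⊎ q ≢ b) → entry p q (a , b , x) ≡ 0R
entry-miss-high p q a b x a≤N N<q differs = entry-miss x differs (ℕP.>⇒≢ (ℕP.≤-<-trans a≤N N<q))

low-vanishes : ∀ {N p q} → N < q → ∀ e → LowEdge N e → entry p q e ≡ 0R
low-vanishes {p = p} {q} N<q (a , b , x) (a≤N , b≤N , _) =
  entry-miss-high p q a b x a≤N N<q (inj₂ (ℕP.>⇒≢ (ℕP.≤-<-trans b≤N N<q)))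

⊕-identityˡ : ∀ x → 0R ⊕ x ≡ x
⊕-identityˡ x = cong₂ _+_ω (ℤP.+-identityˡ (re x)) (ℤP.+-identityˡ (im x))

sum-vanishing-prefix : ∀ (f : Edge → R) {xs} ys → All (λ e → f e ≡ 0R) xs →
  sumR (map f (xs ++ ys)) ≡ sumR (map f ys)
sum-vanishing-prefix f ys []                = refl
sum-vanishing-prefix f ys (_∷_ {xs = xs} f≡0 hs) =
  trans (cong (_⊕ sumR (map f (xs ++ ys))) f≡0)
        (trans (⊕-identityˡ _) (sum-vanishing-prefix f ys hs))

-- The family T⁴_{2k}, T⁴′_{2k} for k = m + 2, so L = m + 1 and N = 2L.

module Family (m : ℕ) where

  L N n : ℕ
  L = suc m
  N = 2 ℕ.* L
  n = 2 ℕ.* suc L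

  rung : ℕ → List Edge
  rung j = (i , suc i , 1R) ∷ (L ℕ.+ i , suc (L ℕ.+ i) , neg 1R)
         ∷ (i , suc (L ℕ.+ i) , 1R) ∷ (suc i , L ℕ.+ i , neg 1R) ∷ []
    where i = suc j

  ladder : List Edge
  ladder = concatMap rung (upTo m)

  special : R → List Edge
  special y = (1 , suc N , ω) ∷ (suc L , suc N , ω) ∷ (L , 2 ℕ.+ N , y) ∷ (N , 2 ℕ.+ N , neg y) ∷ []

  -- T⁴ = graph ω and T⁴′ = graph ω̄, up to reassociating the edge list.
  graph : R → Matrix n
  graph y = adj n (ladder ++ special y)

  T4-graph : T4 (suc L) ≡ graph ω
  T4-graph = cong (adj n) (++-assoc ladder _ _)

  T4′-graph : T4′ (suc L) ≡ graph ω̄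
  T4′-graph = cong (adj n) (++-assoc ladder _ _)

  N≡L+L : N ≡ L ℕ.+ L
  N≡L+L = cong (L ℕ.+_) (ℕP.+-identityʳ L)

  L<N : L < N
  L<N = subst (L <_) (sym N≡L+L) (ℕP.m<m+n L (s≤s z≤n))

  L≤N : L ≤ N
  L≤N = ℕP.<⇒≤ L<N

  -- The squares lie among the low vertices: their top vertex L + i + 1 is at most 2L.
  rung-low : ∀ {j} → j < m → All (LowEdge N) (rung j)
  rung-low {j} j<m =
      (i≤ , i+1≤ , refl) ∷ (L+i≤ , top≤ , refl) ∷ (i≤ , top≤ , refl) ∷ (i+1≤ , L+i≤ , refl) ∷ []
    where
    top≤ : suc (L ℕ.+ suc j) ≤ N
    top≤ = begin
      suc (L ℕ.+ suc j) ≡⟨ sym (ℕP.+-suc L (suc j)) ⟩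
      L ℕ.+ suc (suc j) ≤⟨ ℕP.+-monoʳ-≤ L (s≤s j<m) ⟩
      L ℕ.+ L           ≡⟨ sym N≡L+L ⟩
      N                 ∎
      where open ℕP.≤-Reasoning
    L+i≤ : L ℕ.+ suc j ≤ N
    L+i≤ = ℕP.≤-trans (ℕP.n≤1+n _) top≤
    i+1≤ : suc (suc j) ≤ N
    i+1≤ = ℕP.≤-trans (s≤s (ℕP.m≤n+m (suc j) L)) top≤
    i≤ : suc j ≤ N
    i≤ = ℕP.≤-trans (ℕP.n≤1+n _) i+1≤

  ladder-low : All (LowEdge N) ladder
  ladder-low = concat⁺ (map⁺ (All.map rung-low (all-upTo m)))

  special-oriented : ∀ {y} → On multiplesOfω y → All (Oriented N) (special y)
  special-oriented {y} h =
      (s≤s z≤n , inj₂ (ℕP.≤-refl , refl)) ∷ (L<N , inj₂ (ℕP.≤-refl , refl))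
    ∷ (L≤N , inj₂ (ℕP.n≤1+n _ , h)) ∷ (ℕP.≤-refl , inj₂ (ℕP.n≤1+n _ , on-neg multiplesOfω {y} h)) ∷ []

  graph-placed : ∀ {y} → On multiplesOfω y → ∀ i j → Placed N (num i) (num j) (graph y i j)
  graph-placed h = oriented-placed (++⁺ (All.map (λ {e} → low-oriented e) ladder-low) (special-oriented h))

  n≡2+N : n ≡ 2 ℕ.+ N
  n≡2+N = ℕP.*-distribˡ-+ 2 1 L

  record Vertex (p : ℕ) : Set where
    constructor _numbered_
    field
      index      : Fin n
      has-number : num index ≡ p
  open Vertex

  vertex : ∀ a → a ≤ suc N → Vertex (suc a)
  vertex a a≤ = fromℕ< a<n numbered (cong suc (toℕ-fromℕ< a<n))
    where
    a<n : a < n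
    a<n = subst (suc a ≤_) (sym n≡2+N) (s≤s a≤)

  apart : ∀ {p q} (u : Vertex p) (v : Vertex q) → p ≢ q → index u ≢ index v
  apart u v p≢q u≡v = p≢q (trans (sym (has-number u)) (trans (cong num u≡v) (has-number v)))

  m≤N : m ≤ N
  m≤N = ℕP.≤-trans (ℕP.n≤1+n m) L≤N

  v₁ : Vertex 1
  v₁ = vertex 0 z≤n

  vL : Vertex L
  vL = vertex m (ℕP.m≤n⇒m≤1+n m≤N)

  vL+1 : Vertex (suc L)
  vL+1 = vertex L (ℕP.m≤n⇒m≤1+n L≤N)

  vN : Vertex N
  vN = vertex (pred N) (ℕP.m≤n⇒m≤1+n ℕP.pred[n]≤n)

  vN+1 : Vertex (suc N)
  vN+1 = vertex N (ℕP.n≤1+n N)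

  vN+2 : Vertex (2 ℕ.+ N)
  vN+2 = vertex (suc N) ℕP.≤-refl

  high-column : ∀ y {p q} (u : Vertex p) (v : Vertex q) → N < q →
    graph y (index u) (index v) ≡ sumR (map (entry p q) (special y))
  high-column y {p} {q} (i numbered refl) (j numbered refl) N<q =
    sum-vanishing-prefix (entry p q) (special y)
      (All.map (λ {e} → low-vanishes {p = p} N<q e) ladder-low)

  sum-special : ∀ y p q {v₁ v₂ v₃ v₄} →
    entry p q (1 , suc N , ω) ≡ v₁ → entry p q (suc L , suc N , ω) ≡ v₂ →
    entry p q (L , 2 ℕ.+ N , y) ≡ v₃ → entry p q (N , 2 ℕ.+ N , neg y) ≡ v₄ →
    sumR (map (entry p q) (special y)) ≡ v₁ ⊕ (v₂ ⊕ (v₃ ⊕ (v₄ ⊕ 0R)))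
  sum-special y p q e₁ e₂ e₃ e₄ = cong₂ _⊕_ e₁ (cong₂ _⊕_ e₂ (cong₂ _⊕_ e₃ (cong₂ _⊕_ e₄ refl)))

  N<N+1 : N < suc N
  N<N+1 = ℕP.≤-refl

  N<N+2 : N < 2 ℕ.+ N
  N<N+2 = ℕP.n≤1+n _

  N+1≢N+2 : suc N ≢ 2 ℕ.+ N
  N+1≢N+2 = ℕP.1+n≢n ∘′ sym

  N+2≢N+1 : 2 ℕ.+ N ≢ suc N
  N+2≢N+1 = ℕP.1+n≢n

  L≢N : L ≢ N
  L≢N = ℕP.<⇒≢ L<N

  marked₁ : graph ω̄ (index v₁) (index vN+1) ≡ ω
  marked₁ = trans (high-column ω̄ v₁ vN+1 N<N+1)
    (sum-special ω̄ 1 (suc N)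
      (entry-hit 1 (suc N) ω)
      (entry-miss-high 1 (suc N) (suc L) (suc N) ω L<N N<N+1 (inj₁ λ ()))
      (entry-miss-high 1 (suc N) L (2 ℕ.+ N) ω̄ L≤N N<N+1 (inj₂ N+1≢N+2))
      (entry-miss-high 1 (suc N) N (2 ℕ.+ N) (neg ω̄) ℕP.≤-refl N<N+1 (inj₂ N+1≢N+2)))

  marked₂ : graph ω̄ (index vL+1) (index vN+1) ≡ ω
  marked₂ = trans (high-column ω̄ vL+1 vN+1 N<N+1)
    (sum-special ω̄ (suc L) (suc N)
      (entry-miss-high (suc L) (suc N) 1 (suc N) ω (s≤s z≤n) N<N+1 (inj₁ λ ()))
      (entry-hit (suc L) (suc N) ω)
      (entry-miss-high (suc L) (suc N) L (2 ℕ.+ N) ω̄ L≤N N<N+1 (inj₂ N+1≢N+2))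
      (entry-miss-high (suc L) (suc N) N (2 ℕ.+ N) (neg ω̄) ℕP.≤-refl N<N+1 (inj₂ N+1≢N+2)))

  marked₃ : graph ω̄ (index vL) (index vN+2) ≡ ω̄
  marked₃ = trans (high-column ω̄ vL vN+2 N<N+2)
    (sum-special ω̄ L (2 ℕ.+ N)
      (entry-miss-high L (2 ℕ.+ N) 1 (suc N) ω (s≤s z≤n) N<N+2 (inj₂ N+2≢N+1))
      (entry-miss-high L (2 ℕ.+ N) (suc L) (suc N) ω L<N N<N+2 (inj₂ N+2≢N+1))
      (entry-hit L (2 ℕ.+ N) ω̄)
      (entry-miss-high L (2 ℕ.+ N) N (2 ℕ.+ N) (neg ω̄) ℕP.≤-refl N<N+2 (inj₁ L≢N)))

  marked₄ : graph ω̄ (index vN) (index vN+2) ≡ neg ω̄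
  marked₄ = trans (high-column ω̄ vN vN+2 N<N+2)
    (sum-special ω̄ N (2 ℕ.+ N)
      (entry-miss-high N (2 ℕ.+ N) 1 (suc N) ω (s≤s z≤n) N<N+2 (inj₂ N+2≢N+1))
      (entry-miss-high N (2 ℕ.+ N) (suc L) (suc N) ω L<N N<N+2 (inj₂ N+2≢N+1))
      (entry-miss-high N (2 ℕ.+ N) L (2 ℕ.+ N) ω̄ L≤N N<N+2 (inj₁ (L≢N ∘′ sym)))
      (entry-hit N (2 ℕ.+ N) (neg ω̄)))

  pure₁ : Pure multiplesOfω (graph ω̄ (index v₁) (index vN+1))
  pure₁ = subst (Pure multiplesOfω) (sym marked₁) pure-ω

  pure₂ : Pure multiplesOfω (graph ω̄ (index vL+1) (index vN+1))
  pure₂ = subst (Pure multiplesOfω) (sym marked₂) pure-ω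

  pure₃ : Pure multiplesOfω̄ (graph ω̄ (index vL) (index vN+2))
  pure₃ = subst (Pure multiplesOfω̄) (sym marked₃) pure-ω̄

  pure₄ : Pure multiplesOfω̄ (graph ω̄ (index vN) (index vN+2))
  pure₄ = subst (Pure multiplesOfω̄) (sym marked₄) (pure-neg pure-ω̄)

  HighImages : Permutation′ n → (Line → Line) → Set
  HighImages σ f = ∀ i j {ℓ} → Pure ℓ (graph ω̄ i j) → HighEnd N (num (σ ⟨$⟩ʳ i)) (num (σ ⟨$⟩ʳ j)) (f ℓ)

  three-high : ∀ (σ : Permutation′ n) {p q r} (u : Vertex p) (v : Vertex q) (w : Vertex r) →
    p ≢ q → q ≢ r → p ≢ r →
    N < num (σ ⟨$⟩ʳ index u) → N < num (σ ⟨$⟩ʳ index v) → N < num (σ ⟨$⟩ʳ index w) → ⊥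
  three-high σ u v w p≢q q≢r p≢r =
    at-most-two-high (ℕP.≤-reflexive n≡2+N) (σ ⟨$⟩ʳ index u) (σ ⟨$⟩ʳ index v) (σ ⟨$⟩ʳ index w)
      (apart u v p≢q ∘′ σ-injective σ) (apart v w q≢r ∘′ σ-injective σ) (apart u w p≢r ∘′ σ-injective σ)

  not-preserving : ∀ σ → HighImages σ (λ ℓ → ℓ) → ⊥
  not-preserving σ high =
    three-high σ vN+1 vL vN (ℕP.>⇒≢ (s≤s L≤N)) L≢N ℕP.1+n≢n
      (high (index v₁) (index vN+1) pure₁)
      (high (index vL) (index vN+2) pure₃)
      (high (index vN) (index vN+2) pure₄)

  not-flipping : ∀ σ → HighImages σ flip → ⊥
  not-flipping σ high =
    three-high σ v₁ vL+1 vN+2 (λ ()) (ℕP.<⇒≢ (s≤s (s≤s L≤N))) (λ ())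
      (high (index v₁) (index vN+1) pure₁)
      (high (index vL+1) (index vN+1) pure₂)
      (high (index vL) (index vN+2) pure₃)

  not-equivalent : ¬ Equivalent (graph ω) (graph ω̄)
  not-equivalent (t , σ , ε , eq) = by-twist t (transfer (graph-placed refl) t σ ε eq)
    where
    by-twist : ∀ t → HighImages σ (twistLine t) → ⊥
    by-twist plain     = not-preserving σ
    by-twist negate    = not-preserving σ
    by-twist conjugate = not-flipping σ
    by-twist negconj   = not-flipping σ

proposition4 : (k : ℕ) → 2 ≤ k → ¬ Equivalent (T4 k) (T4′ k)
proposition4 zero          ()
proposition4 (suc zero)    (s≤s ())
proposition4 (suc (suc m)) _ = not-equivalent ∘′ subst₂ Equivalent T4-graph T4′-graph
  where open Family m
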